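{- For all integers $0 \leq k \leq n$, $\mathrm{frst}(n,k)$ equals the number of weak partitions with exactly $n-k$ parts, each part at most $k$, such that each odd part value occurring has even multiplicity.
   Context: A weak partition is a finite non-decreasing sequence of non-negative integers $\lambda_1 \leq \cdots \leq \lambda_m$; its parts are the $\lambda_i$, and the multiplicity of a value is the number of indices $i$ with $\lambda_i$ equal to that value. For $0 \leq k \leq n$, $\mathrm{frst}(n,k)$ is defined as the number of weak partitions with exactly $n-k$ parts, each part at most $k$, such that: (a) if $k$ is even, each odd part has even multiplicity; (b) if $k$ is odd, each even part (including $0$) has even multiplicity. -}

module Defs where

open import Data.Nat using (ℕ; zero; suc; _≤_; _≤?_; _≟_)
open import Data.Nat.Divisibility using (_∣_; _∣?_)
open import Data.List using (List; []; _∷_; [_]; map; concatMap; upTo; length; filter)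
open import Data.List.Relation.Unary.All using (All; all?)
open import Data.List.Relation.Unary.Linked using (Linked; linked?)
open import Data.Product using (_×_)
open import Relation.Nullary using (Dec; ¬_; ¬?; _×-dec_; _→-dec_)

listsUpTo : ℕ → ℕ → List (List ℕ)
listsUpTo zero    k = [ [] ]
listsUpTo (suc m) k = concatMap (λ x → map (x ∷_) (listsUpTo m k)) (upTo (suc k))

mult : ℕ → List ℕ → ℕ
mult v l = length (filter (v ≟_) l)

WeakPartition : List ℕ → Set
WeakPartition l = Linked _≤_ l

weakPartition? : (l : List ℕ) → Dec (WeakPartition l)
weakPartition? = linked? _≤?_

-- Parity conditions of frst(n,k) for a list l (given k):
-- (a) k even: every odd part has even multiplicity
-- (b) k odd : every even part (incl. 0) has even multiplicity
FrstCond : ℕ → List ℕ → Set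
FrstCond k l = All (λ x → (2 ∣ k → ¬ (2 ∣ x) → 2 ∣ mult x l)
                         × (¬ (2 ∣ k) → 2 ∣ x → 2 ∣ mult x l)) l

frstCond? : (k : ℕ) → (l : List ℕ) → Dec (FrstCond k l)
frstCond? k l = all? (λ x → ((2 ∣? k) →-dec (¬? (2 ∣? x) →-dec (2 ∣? mult x l)))
                            ×-dec (¬? (2 ∣? k) →-dec ((2 ∣? x) →-dec (2 ∣? mult x l)))) l

OddEvenMult : List ℕ → Set
OddEvenMult l = All (λ x → ¬ (2 ∣ x) → 2 ∣ mult x l) l

oddEvenMult? : (l : List ℕ) → Dec (OddEvenMult l)
oddEvenMult? l = all? (λ x → ¬? (2 ∣? x) →-dec (2 ∣? mult x l)) l

frst : ℕ → ℕ → ℕ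
frst n k = length (filter (λ l → weakPartition? l ×-dec frstCond? k l)
                          (listsUpTo (n Data.Nat.∸ k) k))

oddEvenCount : ℕ → ℕ → ℕ
oddEvenCount n k = length (filter (λ l → weakPartition? l ×-dec oddEvenMult? l)
                                  (listsUpTo (n Data.Nat.∸ k) k))

module Submission where

-- Both sides of the theorem count the weak partitions in the list
-- L = listsUpTo (n ∸ k) k of all length-(n ∸ k) lists with entries ≤ k,
-- filtered by two parity conditions.
--
-- * k even: the condition (a) of frst says exactly "odd parts have even
--   multiplicity", so the two filters coincide pointwise.
-- * k odd: the complement map  z ↦ reverse (map (k ∸_) z)  is an involution
--   of L which preserves weak partitions and multiplicities (the value x
--   becomes k ∸ x).  Since k is odd, x and k ∸ x have opposite parities, so
--   the complement swaps condition (b) with "odd parts have even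
--   multiplicity", and the two counts agree.

open import Defs
open import Data.Nat using (ℕ; zero; suc; _≤_; _∸_; _≟_; s≤s; s≤s⁻¹; z≤n)
open import Data.Nat.Properties
  using (≤-antisym; suc-injective; m∸n≤m; m≤n⇒m≤1+n; ∸-monoʳ-≤; m∸[m∸n]≡n; ∸-cancelˡ-≡; +-∸-assoc)
open import Data.Nat.Divisibility using (_∣_; _∣?_; divides; ∣m∣n⇒∣m+n; ∣m+n∣m⇒∣n; ∣m∸n∣n⇒∣m)
open import Data.List
  using (List; []; _∷_; map; upTo; length; filter; reverse; reverseAcc; _++_; concat; cartesianProductWith)
open import Data.List.Properties
  using (length-++-sucʳ; reverse-involutive; reverse-map; length-reverse; length-map;
         filter-accept; filter-reject; filter-≐; ∷-injective)
open import Data.List.Relation.Unary.All as All using (All; []; _∷_)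
import Data.List.Relation.Unary.All.Properties as AllP
open import Data.List.Relation.Unary.Any using (here; there)
open import Data.List.Relation.Unary.Linked as Linked using (Linked; []; [-]; _∷_)
import Data.List.Relation.Unary.Linked.Properties as LinkedP
open import Data.List.Relation.Unary.Unique.Propositional using (Unique)
open import Data.List.Relation.Unary.AllPairs using ([]; _∷_)
open import Data.List.Relation.Unary.Unique.Propositional.Properties
  using (cartesianProductWith⁺; upTo⁺; filter⁺)
open import Data.List.Membership.Propositional using (_∈_)
open import Data.List.Membership.Propositional.Properties
  using (∈-cartesianProductWith⁺; ∈-cartesianProductWith⁻; ∈-upTo⁺; ∈-upTo⁻;
         ∈-filter⁺; ∈-filter⁻; ∈-∃++)
open import Data.List.Relation.Binary.Permutation.Propositional using (↭-sym)
open import Data.List.Relation.Binary.Permutation.Propositional.Properties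
  using (↭-reverse; All-resp-↭; filter-↭; ↭-length)
open import Data.Product using (_×_; _,_; proj₁; proj₂)
open import Data.Empty using (⊥-elim)
open import Relation.Nullary using (yes; no; ¬_)
open import Relation.Unary using (Pred; Decidable; _≐_)
open import Relation.Binary.PropositionalEquality
  using (_≡_; refl; sym; trans; cong; cong₂; subst; _≢_; module ≡-Reasoning)
open import Level using (0ℓ)
open import Function using (flip)

∈-remove : ∀ {A : Set} {y v : A} (as bs : List A) →
           y ∈ as ++ v ∷ bs → y ≢ v → y ∈ as ++ bs
∈-remove []       bs (here y≡v) y≢v = ⊥-elim (y≢v y≡v)
∈-remove []       bs (there y∈) y≢v = y∈
∈-remove (a ∷ as) bs (here y≡a) y≢v = here y≡a
∈-remove (a ∷ as) bs (there y∈) y≢v = there (∈-remove as bs y∈ y≢v)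

length-≤-injection : ∀ {A B : Set} (f : A → B) {xs : List A} (ys : List B) → Unique xs →
                     (∀ {z} → z ∈ xs → f z ∈ ys) →
                     (∀ {z w} → z ∈ xs → w ∈ xs → f z ≡ f w → z ≡ w) →
                     length xs ≤ length ys
length-≤-injection f {[]}     ys _          _    _   = z≤n
length-≤-injection f {x ∷ xs} ys (x∉xs ∷ xs!) into inj with ∈-∃++ (into (here refl))
... | as , bs , refl =
  subst (suc (length xs) ≤_) (sym (length-++-sucʳ as (f x) bs))
    (s≤s (length-≤-injection f (as ++ bs) xs! into′ (λ z∈ w∈ → inj (there z∈) (there w∈))))
  where
  -- f x is hit only by x, so the other images avoid the removed occurrence
  into′ : ∀ {z} → z ∈ xs → f z ∈ as ++ bs
  into′ z∈ = ∈-remove as bs (into (there z∈))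
               (λ fz≡fx → All.lookup x∉xs z∈ (inj (here refl) (there z∈) (sym fz≡fx)))

record InvolutionOn {A : Set} (f : A → A) (L : List A) : Set where
  field
    closed     : ∀ {z} → z ∈ L → f z ∈ L
    involutive : ∀ {z} → z ∈ L → f (f z) ≡ z

module _ {A : Set} {f : A → A} {L : List A} (L! : Unique L) (inv : InvolutionOn f L) where
  open InvolutionOn inv

  count-≤ : ∀ {P Q : Pred A 0ℓ} (P? : Decidable P) (Q? : Decidable Q) →
            (∀ {z} → z ∈ L → P z → Q (f z)) →
            length (filter P? L) ≤ length (filter Q? L)
  count-≤ P? Q? P⇒Qf = length-≤-injection f _ (filter⁺ P? L!) into inj
    where
    into : ∀ {z} → z ∈ filter P? L → f z ∈ filter Q? L
    into z∈ = let (z∈L , Pz) = ∈-filter⁻ P? z∈ in ∈-filter⁺ Q? (closed z∈L) (P⇒Qf z∈L Pz)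
    inj : ∀ {z w} → z ∈ filter P? L → w ∈ filter P? L → f z ≡ f w → z ≡ w
    inj {z} {w} z∈ w∈ fz≡fw = begin
      z         ≡⟨ sym (involutive (proj₁ (∈-filter⁻ P? z∈))) ⟩
      f (f z)   ≡⟨ cong f fz≡fw ⟩
      f (f w)   ≡⟨ involutive (proj₁ (∈-filter⁻ P? w∈)) ⟩
      w         ∎
      where open ≡-Reasoning

  count-swap : ∀ {P Q : Pred A 0ℓ} (P? : Decidable P) (Q? : Decidable Q) →
               (∀ {z} → z ∈ L → P z → Q (f z)) →
               (∀ {z} → z ∈ L → Q z → P (f z)) →
               length (filter P? L) ≡ length (filter Q? L)
  count-swap P? Q? P⇒Qf Q⇒Pf = ≤-antisym (count-≤ P? Q? P⇒Qf) (count-≤ Q? P? Q⇒Pf)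

listsUpTo-suc : ∀ m k → listsUpTo (suc m) k ≡ cartesianProductWith _∷_ (upTo (suc k)) (listsUpTo m k)
listsUpTo-suc m k = concatMap≡cartesianProductWith (upTo (suc k))
  where
  concatMap≡cartesianProductWith : ∀ xs →
    concat (map (λ x → map (x ∷_) (listsUpTo m k)) xs) ≡ cartesianProductWith _∷_ xs (listsUpTo m k)
  concatMap≡cartesianProductWith []       = refl
  concatMap≡cartesianProductWith (x ∷ xs) = cong (map (x ∷_) (listsUpTo m k) ++_) (concatMap≡cartesianProductWith xs)

listsUpTo-unique : ∀ m k → Unique (listsUpTo m k)
listsUpTo-unique zero    k = [] ∷ []
listsUpTo-unique (suc m) k = subst Unique (sym (listsUpTo-suc m k))
  (cartesianProductWith⁺ _∷_ ∷-injective (upTo⁺ (suc k)) (listsUpTo-unique m k))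

∈-listsUpTo⁻ : ∀ m k {z} → z ∈ listsUpTo m k → length z ≡ m × All (_≤ k) z
∈-listsUpTo⁻ zero    k (here refl) = refl , []
∈-listsUpTo⁻ (suc m) k z∈ with ∈-cartesianProductWith⁻ _∷_ (upTo (suc k)) (listsUpTo m k)
                                 (subst (_ ∈_) (listsUpTo-suc m k) z∈)
... | x , z′ , x∈ , z′∈ , refl = let (len , bounded) = ∈-listsUpTo⁻ m k z′∈ in
                                 cong suc len , s≤s⁻¹ (∈-upTo⁻ x∈) ∷ bounded

∈-listsUpTo⁺ : ∀ m k {z} → length z ≡ m → All (_≤ k) z → z ∈ listsUpTo m k
∈-listsUpTo⁺ zero    k {[]}    refl []             = here refl
∈-listsUpTo⁺ (suc m) k {x ∷ z} len  (x≤k ∷ bounded) = subst (_ ∈_) (sym (listsUpTo-suc m k))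
  (∈-cartesianProductWith⁺ _∷_ (∈-upTo⁺ (s≤s x≤k)) (∈-listsUpTo⁺ m k (suc-injective len) bounded))

complement : ℕ → List ℕ → List ℕ
complement k z = reverse (map (k ∸_) z)

complement-All : ∀ {P : Pred ℕ 0ℓ} k z → All (λ x → P (k ∸ x)) z → All P (complement k z)
complement-All k z all = All-resp-↭ (↭-sym (↭-reverse (map (k ∸_) z))) (AllP.map⁺ all)

complement-length : ∀ k z → length (complement k z) ≡ length z
complement-length k z = trans (length-reverse (map (k ∸_) z)) (length-map (k ∸_) z)

complement-bounded : ∀ k z → All (_≤ k) (complement k z)
complement-bounded k z = complement-All k z (All.universal (m∸n≤m k) z)

complement-involutive : ∀ k z → All (_≤ k) z → complement k (complement k z) ≡ z
complement-involutive k z bounded = begin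
  reverse (map (k ∸_) (reverse (map (k ∸_) z)))  ≡⟨ cong reverse (reverse-map (k ∸_) (map (k ∸_) z)) ⟩
  reverse (reverse (map (k ∸_) (map (k ∸_) z)))  ≡⟨ reverse-involutive (map (k ∸_) (map (k ∸_) z)) ⟩
  map (k ∸_) (map (k ∸_) z)                      ≡⟨ reflect-twice z bounded ⟩
  z                                              ∎
  where
  open ≡-Reasoning
  reflect-twice : ∀ z → All (_≤ k) z → map (k ∸_) (map (k ∸_) z) ≡ z
  reflect-twice []      []               = refl
  reflect-twice (x ∷ z) (x≤k ∷ bounded) = cong₂ _∷_ (m∸[m∸n]≡n x≤k) (reflect-twice z bounded)

Linked-reverse : ∀ {A : Set} {R : A → A → Set} {xs} → Linked R xs → Linked (flip R) (reverse xs)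
Linked-reverse {R = R} {[]}     []    = []
Linked-reverse {R = R} {x ∷ xs} chain = reverse-onto chain [-]
  where
  -- invariant: the accumulator, headed by the current element, is a flipped chain
  reverse-onto : ∀ {x xs acc} → Linked R (x ∷ xs) → Linked (flip R) (x ∷ acc) →
                 Linked (flip R) (reverseAcc (x ∷ acc) xs)
  reverse-onto [-]         done = done
  reverse-onto (r ∷ chain) done = reverse-onto chain (r ∷ done)

complement-weakPartition : ∀ k {z} → WeakPartition z → WeakPartition (complement k z)
complement-weakPartition k wp = Linked-reverse (LinkedP.map⁺ (Linked.map (∸-monoʳ-≤ k) wp))

mult-here : ∀ {x y} z → x ≡ y → mult x (y ∷ z) ≡ suc (mult x z)
mult-here {x} z x≡y = cong length (filter-accept (x ≟_) x≡y)

mult-there : ∀ {x y} z → x ≢ y → mult x (y ∷ z) ≡ mult x z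
mult-there {x} z x≢y = cong length (filter-reject (x ≟_) x≢y)

mult-map : ∀ (f : ℕ → ℕ) x z → All (λ y → f y ≡ f x → y ≡ x) z → mult (f x) (map f z) ≡ mult x z
mult-map f x []      []           = refl
mult-map f x (y ∷ z) (inj ∷ injs) with x ≟ y
... | yes x≡y = trans (mult-here (map f z) (cong f x≡y))
                      (trans (cong suc (mult-map f x z injs)) (sym (mult-here z x≡y)))
... | no  x≢y = trans (mult-there (map f z) (λ fx≡fy → x≢y (sym (inj (sym fx≡fy)))))
                      (trans (mult-map f x z injs) (sym (mult-there z x≢y)))

-- Reflection is injective on the values ≤ k, so the complement maps the
-- multiplicity of x to that of k ∸ x.
complement-mult : ∀ k z {x} → x ≤ k → All (_≤ k) z → mult (k ∸ x) (complement k z) ≡ mult x z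
complement-mult k z {x} x≤k bounded = begin
  mult (k ∸ x) (reverse (map (k ∸_) z))  ≡⟨ ↭-length (filter-↭ ((k ∸ x) ≟_) (↭-reverse (map (k ∸_) z))) ⟩
  mult (k ∸ x) (map (k ∸_) z)            ≡⟨ mult-map (k ∸_) x z (All.map (λ y≤k → ∸-cancelˡ-≡ y≤k x≤k) bounded) ⟩
  mult x z                               ∎
  where open ≡-Reasoning

complement-involution : ∀ m k → InvolutionOn (complement k) (listsUpTo m k)
complement-involution m k = record
  { closed     = λ {z} z∈ → ∈-listsUpTo⁺ m k (trans (complement-length k z) (proj₁ (∈-listsUpTo⁻ m k z∈)))
                                              (complement-bounded k z)
  ; involutive = λ {z} z∈ → complement-involutive k z (proj₂ (∈-listsUpTo⁻ m k z∈))
  }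

odd⇒even-suc : ∀ a → ¬ 2 ∣ a → 2 ∣ suc a
odd⇒even-suc zero    a-odd = ⊥-elim (a-odd (divides 0 refl))
odd⇒even-suc (suc a) a-odd with 2 ∣? a
... | yes 2∣a = ∣m∣n⇒∣m+n {m = 2} (divides 1 refl) 2∣a
... | no  2∤a = ⊥-elim (a-odd (odd⇒even-suc a 2∤a))

odd-complement⇒even : ∀ {k x} → x ≤ k → ¬ 2 ∣ x → ¬ 2 ∣ (k ∸ x) → 2 ∣ k
odd-complement⇒even {k} {x} x≤k x-odd kx-odd = ∣m+n∣m⇒∣n {m = 2} 2∣2+k (divides 1 refl)
  where
  -- 2 + k = (2 + k ∸ (1 + x)) + (1 + x), where 2 + k ∸ (1 + x) = 1 + (k ∸ x)
  2∣2+k : 2 ∣ suc (suc k)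
  2∣2+k = ∣m∸n∣n⇒∣m 2 (s≤s (m≤n⇒m≤1+n x≤k))
            (subst (2 ∣_) (sym (+-∸-assoc 1 x≤k)) (odd⇒even-suc (k ∸ x) kx-odd))
            (odd⇒even-suc x x-odd)

even-conditions-agree : ∀ {k} → 2 ∣ k →
  (λ l → WeakPartition l × FrstCond k l) ≐ (λ l → WeakPartition l × OddEvenMult l)
even-conditions-agree k-even =
  (λ (wp , cond) → wp , All.map (λ clauses → proj₁ clauses k-even) cond) ,
  (λ (wp , cond) → wp , All.map (λ clause → (λ _ → clause) , (λ k-odd → ⊥-elim (k-odd k-even))) cond)

-- For k odd, the complement turns condition (b) into "odd parts have even
-- multiplicity": an odd k ∸ x comes from an even x.
frst⇒oddEven : ∀ {k z} → ¬ 2 ∣ k → All (_≤ k) z → FrstCond k z → OddEvenMult (complement k z)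
frst⇒oddEven {k} {z} k-odd bounded cond = complement-All k z (All.zipWith clause (bounded , cond))
  where
  clause : ∀ {x} → x ≤ k × (2 ∣ k → ¬ 2 ∣ x → 2 ∣ mult x z) × (¬ 2 ∣ k → 2 ∣ x → 2 ∣ mult x z) →
           ¬ 2 ∣ (k ∸ x) → 2 ∣ mult (k ∸ x) (complement k z)
  clause {x} (x≤k , _ , even-clause) kx-odd with 2 ∣? x
  ... | yes x-even = subst (2 ∣_) (sym (complement-mult k z x≤k bounded)) (even-clause k-odd x-even)
  ... | no  x-odd  = ⊥-elim (k-odd (odd-complement⇒even x≤k x-odd kx-odd))

-- Conversely an even k ∸ x comes from an odd x.
oddEven⇒frst : ∀ {k z} → ¬ 2 ∣ k → All (_≤ k) z → OddEvenMult z → FrstCond k (complement k z)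
oddEven⇒frst {k} {z} k-odd bounded cond = complement-All k z (All.zipWith clause (bounded , cond))
  where
  clause : ∀ {x} → x ≤ k × (¬ 2 ∣ x → 2 ∣ mult x z) →
           (2 ∣ k → ¬ 2 ∣ (k ∸ x) → 2 ∣ mult (k ∸ x) (complement k z)) ×
           (¬ 2 ∣ k → 2 ∣ (k ∸ x) → 2 ∣ mult (k ∸ x) (complement k z))
  clause {x} (x≤k , odd-clause) =
    (λ k-even _ → ⊥-elim (k-odd k-even)) ,
    (λ _ kx-even → subst (2 ∣_) (sym (complement-mult k z x≤k bounded))
                     (odd-clause (λ x-even → k-odd (∣m∸n∣n⇒∣m 2 x≤k kx-even x-even))))

lemma3p2 : (n k : ℕ) → k ≤ n → frst n k ≡ oddEvenCount n k
lemma3p2 n k _ with 2 ∣? k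
... | yes k-even = cong length (filter-≐ _ _ (even-conditions-agree k-even) (listsUpTo (n ∸ k) k))
... | no  k-odd  = count-swap (listsUpTo-unique m k) (complement-involution m k) _ _
  (λ z∈ (wp , cond) → complement-weakPartition k wp , frst⇒oddEven k-odd (bounded z∈) cond)
  (λ z∈ (wp , cond) → complement-weakPartition k wp , oddEven⇒frst k-odd (bounded z∈) cond)
  where
  m : ℕ
  m = n ∸ k
  bounded : ∀ {z} → z ∈ listsUpTo m k → All (_≤ k) z
  bounded z∈ = proj₂ (∈-listsUpTo⁻ m k z∈)
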